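{- Let $q\ge 2$ and let $M$ be the star matrix of a partition of ${\bf Z}_q^n$ into subcubes all of the same dimension. Suppose $M$ contains a transfractal $T$, with row set $I$ and column set $J$. Then any two rows $r_1,r_2\in I$ coincide in every column not in $J$, i.e. $M_{r_1,c}=M_{r_2,c}$ for all columns $c\notin J$ (entries being elements of ${\bf Z}_q\cup\{*\}$).
   Context: A subcube of ${\bf Z}_q^n$ is a set obtained by fixing some coordinates to given elements of ${\bf Z}_q$ and letting the others run over ${\bf Z}_q$; its dimension is the number of free coordinates; its star pattern is the vector in $({\bf Z}_q\cup\{*\})^n$ with the fixed value at fixed coordinates and $*$ at free ones. The star matrix of a partition into subcubes has as rows the star patterns of the subcubes. Fractal matrices: $M_{q,0}$ is the $1\times 0$ matrix; for $l\ge1$, $M_{q,l}$ is the $q^l\times\frac{q^l-1}{q-1}$ matrix whose rows are split into $q$ consecutive blocks $B_0,\dots,B_{q-1}$ of $q^{l-1}$ rows, whose first column equals $a$ on every row of $B_a$, and whose remaining columns are split into $q$ consecutive groups $G_0,\dots,G_{q-1}$ of $\frac{q^{l-1}-1}{q-1}$ columns each, where the submatrix on $B_a\times G_a$ is $M_{q,l-1}$ and the submatrix on $B_a\times G_b$ for $b\ne a$ consists only of $*$. A matrix is called fractal if it is obtained from some $M_{q,l}$ by permuting rows and columns. A submatrix $T$ of $M$ (given by a set $I$ of rows and a set $J$ of columns, not necessarily consecutive) is a transfractal if $T$ is fractal with $|I|=q^l$ for some $l\ge 1$, and every column $c\in J$ has only $*$ entries in the rows of $M$ not in $I$. -}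

module Defs where

open import Data.Nat using (ℕ; zero; suc; _+_; _*_; _^_; _≤_)
open import Data.Fin using (Fin; zero; suc; splitAt; remQuot; _≟_)
open import Data.Maybe using (Maybe; just; nothing)
open import Data.Sum using (inj₁; inj₂)
open import Data.Product using (Σ; ∃; _×_; _,_)
open import Relation.Nullary using (¬_; yes; no)
open import Relation.Binary.PropositionalEquality using (_≡_)
open import Function.Bundles using (_↔_; Inverse)

-- Entries of a star matrix: elements of Z_q ∪ {*}; `just a` is a ∈ Z_q, `nothing` is *.
Entry : ℕ → Set
Entry q = Maybe (Fin q)

Pattern : ℕ → ℕ → Set
Pattern q n = Fin n → Entry q

Matrix : ℕ → ℕ → ℕ → Set
Matrix q m n = Fin m → Fin n → Entry q

_∈cube_ : ∀ {q n} → (Fin n → Fin q) → Pattern q n → Set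
x ∈cube p = ∀ i a → p i ≡ just a → x i ≡ a

dim : ∀ {q n} → Pattern q n → ℕ
dim {n = zero}  p = 0
dim {n = suc n} p with p zero
... | nothing = suc (dim (λ i → p (suc i)))
... | just _  = dim (λ i → p (suc i))

IsPartitionStarMatrix : ∀ {q m n} → Matrix q m n → Set
IsPartitionStarMatrix {q} {m} {n} M =
  ∀ (x : Fin n → Fin q) →
    (∃ λ (r : Fin m) → x ∈cube M r) ×
    (∀ r r' → x ∈cube M r → x ∈cube M r' → r ≡ r')

SameDimension : ∀ {q m n} → Matrix q m n → Set
SameDimension {m = m} M = ∃ λ d → ∀ (r : Fin m) → dim (M r) ≡ d

-- Number of columns of M_{q,l}: (q^l - 1)/(q - 1) = 1 + q + ... + q^(l-1).
cols : ℕ → ℕ → ℕ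
cols q zero    = 0
cols q (suc l) = 1 + q * cols q l

-- The fractal matrix M_{q,l}: rows split into q consecutive blocks B_a
-- (remQuot gives block index a and position in block), first column = a,
-- remaining columns split into q consecutive groups G_b.
fractalM : (q l : ℕ) → Matrix q (q ^ l) (cols q l)
fractalM q zero    r ()
fractalM q (suc l) r c with remQuot {q} (q ^ l) r | splitAt 1 c
... | a , r' | inj₁ _  = just a
... | a , r' | inj₂ c' with remQuot {q} (cols q l) c'
...   | b , c'' with a ≟ b
...     | yes _ = fractalM q l r' c''
...     | no  _ = nothing

IsFractalOfLevel : ∀ {q R C} → ℕ → Matrix q R C → Set
IsFractalOfLevel {q} {R} {C} l A =
  Σ (Fin R ↔ Fin (q ^ l)) λ σ → Σ (Fin C ↔ Fin (cols q l)) λ τ →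
    ∀ i j → A i j ≡ fractalM q l (Inverse.to σ i) (Inverse.to τ j)

-- Row set I given as the image of an injective map ι : Fin R → Fin m,
-- column set J as the image of an injective map κ : Fin C → Fin n.
InImage : ∀ {k m} → (Fin k → Fin m) → Fin m → Set
InImage f r = ∃ λ i → f i ≡ r

Injective : ∀ {k m} → (Fin k → Fin m) → Set
Injective f = ∀ i j → f i ≡ f j → i ≡ j

IsTransfractal : ∀ {q m n R C} → Matrix q m n →
                 (Fin R → Fin m) → (Fin C → Fin n) → Set
IsTransfractal {q} {m} {n} {R} {C} M ι κ =
  Injective ι × Injective κ ×
  (∃ λ l → 1 ≤ l × IsFractalOfLevel l (λ i j → M (ι i) (κ j))) ×
  (∀ (j : Fin C) (r : Fin m) → ¬ InImage ι r → M r (κ j) ≡ nothing)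

{-# OPTIONS --safe #-}
module Submission where

-- Let x agree with row i of the transfractal outside its columns J. Overwrite the
-- J-coordinates of x by the fixed entries of row i' and let r be the subcube containing
-- the resulting point y. Distinct rows of a fractal matrix clash in some column, so r is
-- no other row of T. Nor is r outside T: such a row is all-* on J, so it would also contain
-- the point obtained from x via row i, which already lies in row i. Hence r is row i', and
-- x, which equals y outside J, agrees with row i' there. So rows i and i' cut out the same
-- subcube outside J, and for q ≥ 2 a subcube determines its star pattern.

open import Defs
open import Data.Nat using (ℕ; zero; suc; _^_; _≤_; s≤s)
open import Data.Fin using (Fin; zero; suc; combine; punchIn; _≟_)
open import Data.Fin.Properties using (any?; combine-surjective; remQuot-combine; punchInᵢ≢i)
open import Data.Maybe using (Maybe; just; nothing; fromMaybe)
open import Data.Product using (∃; ∃₂; _×_; _,_; proj₁; proj₂; swap)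
open import Data.Empty using (⊥-elim)
open import Function using (_∘_)
open import Function.Bundles using (Inverse; Injection)
open import Function.Properties.Inverse using (Inverse⇒Injection)
open import Relation.Nullary using (¬_; yes; no)
open import Relation.Binary.PropositionalEquality

private variable
  q n : ℕ

AgreesOn : (Fin n → Set) → Pattern q n → (Fin n → Fin q) → Set
AgreesOn P p x = ∀ c → P c → ∀ a → p c ≡ just a → x c ≡ a

Conflicting : Pattern q n → Pattern q n → Set
Conflicting {q} p p' = ∃ λ c → ∃₂ λ (a b : Fin q) → p c ≡ just a × p' c ≡ just b × a ≢ b

conflicting⇒disjoint : ∀ {p p' : Pattern q n} {x} → Conflicting p p' → x ∈cube p → ¬ x ∈cube p'
conflicting⇒disjoint (c , a , b , pc≡a , p'c≡b , a≢b) x∈p x∈p' =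
  a≢b (trans (sym (x∈p c a pc≡a)) (x∈p' c b p'c≡b))

fill : Pattern q n → (Fin n → Fin q) → Fin n → Fin q
fill p x c = fromMaybe (x c) (p c)

fill-∈cube : ∀ (p : Pattern q n) x → fill p x ∈cube p
fill-∈cube p x c a pc≡a rewrite pc≡a = refl

just-⇔⇒≡ : ∀ {A : Set} {u v : Maybe A} →
           (∀ {a} → u ≡ just a → v ≡ just a) → (∀ {a} → v ≡ just a → u ≡ just a) → u ≡ v
just-⇔⇒≡ {u = just a}  u⇒v v⇒u = sym (u⇒v refl)
just-⇔⇒≡ {u = nothing} {just b}  u⇒v v⇒u = v⇒u refl
just-⇔⇒≡ {u = nothing} {nothing} u⇒v v⇒u = refl

module _ {k : ℕ} {P : Fin n → Set} where

  agreesOn-⊆⇒fixed-⊇ : {p p' : Pattern (suc (suc k)) n} →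
                       (∀ x → AgreesOn P p x → AgreesOn P p' x) →
                       ∀ {c b} → P c → p' c ≡ just b → p c ≡ just b
  agreesOn-⊆⇒fixed-⊇ {p} p⊆p' {c} {b} Pc p'c≡b = at-c (p⊆p' x (λ c _ → fill-∈cube p _ c) c Pc b p'c≡b)
    where
    x : Fin n → Fin (suc (suc k))
    x = fill p (λ _ → punchIn b zero)
    -- x c computes to the entry of p at c if there is one, and to punchIn b zero ≢ b otherwise.
    at-c : x c ≡ b → p c ≡ just b
    at-c xc≡b with p c
    ... | just a  = cong just xc≡b
    ... | nothing = ⊥-elim (punchInᵢ≢i b zero xc≡b)

  agreesOn-⇔⇒≡ : {p p' : Pattern (suc (suc k)) n} →
                 (∀ x → AgreesOn P p x → AgreesOn P p' x) →
                 (∀ x → AgreesOn P p' x → AgreesOn P p x) →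
                 ∀ {c} → P c → p c ≡ p' c
  agreesOn-⇔⇒≡ p⊆p' p'⊆p Pc =
    just-⇔⇒≡ (agreesOn-⊆⇒fixed-⊇ p'⊆p Pc) (agreesOn-⊆⇒fixed-⊇ p⊆p' Pc)

module _ (q l : ℕ) where

  fractalM-head : ∀ a s → fractalM q (suc l) (combine a s) zero ≡ just a
  fractalM-head a s = cong (just ∘ proj₁) (remQuot-combine {q} {q ^ l} a s)

  -- remQuot unfolds to swap ∘ quotRem, so its equation is rewritten in that form.
  fractalM-block : ∀ a s c → fractalM q (suc l) (combine a s) (suc (combine a c)) ≡ fractalM q l s c
  fractalM-block a s c rewrite cong swap (remQuot-combine {q} {q ^ l} a s)
                           | cong swap (remQuot-combine {q} {cols q l} a c)
    with a ≟ a
  ... | yes _   = refl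
  ... | no a≢a = ⊥-elim (a≢a refl)

fractalM-rows-conflict : ∀ q l {r r' : Fin (q ^ l)} → r ≢ r' → Conflicting (fractalM q l r) (fractalM q l r')
fractalM-rows-conflict q zero {zero} {zero} r≢r' = ⊥-elim (r≢r' refl)
fractalM-rows-conflict q (suc l) {r} {r'} r≢r'
  with a , s , refl ← combine-surjective {q} {q ^ l} r
     | a' , s' , refl ← combine-surjective {q} {q ^ l} r'
     | a ≟ a'
... | no a≢a' = zero , a , a' , fractalM-head q l a s , fractalM-head q l a' s' , a≢a'
... | yes refl
  with c , b , b' , e , e' , b≢b' ← fractalM-rows-conflict q l {s} {s'} (r≢r' ∘ cong (combine a))
  = suc (combine a c) , b , b' ,
    trans (fractalM-block q l a s c) e , trans (fractalM-block q l a s' c) e' , b≢b'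

fractal-rows-conflict : ∀ {R C l} {A : Matrix q R C} → IsFractalOfLevel l A →
                        ∀ {i i'} → i ≢ i' → Conflicting (A i) (A i')
fractal-rows-conflict {q} {l = l} {A} (σ , τ , A≡M) {i} {i'} i≢i'
  with c , a , b , e , e' , a≢b ← fractalM-rows-conflict q l (i≢i' ∘ Injection.injective (Inverse⇒Injection σ))
  = Inverse.from τ c , a , b , trans (A-at-from i) e , trans (A-at-from i') e' , a≢b
  where
  A-at-from : ∀ i → A i (Inverse.from τ c) ≡ fractalM q l (Inverse.to σ i) c
  A-at-from i = trans (A≡M i _) (cong (fractalM q l _) (Inverse.strictlyInverseˡ τ c))

module Transfractal {m R C} (M : Matrix q m n) (partition : IsPartitionStarMatrix M)
  {ι : Fin R → Fin m} {κ : Fin C → Fin n}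
  (rows-conflict : ∀ {i i'} → i ≢ i' → Conflicting (M (ι i) ∘ κ) (M (ι i') ∘ κ))
  (stars-outside : ∀ j r → ¬ InImage ι r → M r (κ j) ≡ nothing) where

  OffJ : Fin n → Set
  OffJ c = ¬ InImage κ c

  splice : Pattern q n → (Fin n → Fin q) → Fin n → Fin q
  splice p x c with any? (λ j → κ j ≟ c)
  ... | yes _ = fill p x c
  ... | no _  = x c

  splice-∈cube-on-J : ∀ p x → (splice p x ∘ κ) ∈cube (p ∘ κ)
  splice-∈cube-on-J p x j a e with any? (λ j' → κ j' ≟ κ j)
  ... | yes _  = fill-∈cube p x (κ j) a e
  ... | no κj∉J = ⊥-elim (κj∉J (j , refl))

  splice-off-J : ∀ p x {c} → OffJ c → splice p x c ≡ x c
  splice-off-J p x {c} c∉J with any? (λ j → κ j ≟ c)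
  ... | yes c∈J = ⊥-elim (c∉J c∈J)
  ... | no _    = refl

  splice-∈cube : ∀ {p x} → AgreesOn OffJ p x → splice p x ∈cube p
  splice-∈cube {p} {x} x~p c a e with any? (λ j → κ j ≟ c)
  ... | yes _   = fill-∈cube p x c a e
  ... | no c∉J = x~p c c∉J a e

  splice-∈cube-outside-I : ∀ {r p p' x} → ¬ InImage ι r →
                           splice p x ∈cube M r → splice p' x ∈cube M r
  splice-∈cube-outside-I {r} {p} {x = x} r∉I y∈r c a e with any? (λ j → κ j ≟ c)
  ... | yes (j , refl) with () ← trans (sym (stars-outside j r r∉I)) e
  ... | no c∉J = trans (sym (splice-off-J p x c∉J)) (y∈r c a e)

  splice-cube-in-I : ∀ {i r p x} → AgreesOn OffJ (M (ι i)) x →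
                     splice p x ∈cube M r → InImage ι r
  splice-cube-in-I {i} {r} {x = x} x~i y∈r with any? (λ k → ι k ≟ r)
  ... | yes r∈I = r∈I
  ... | no r∉I  = ⊥-elim (r∉I (i , proj₂ (partition (splice (M (ι i)) x)) (ι i) r
                                    (splice-∈cube x~i) (splice-∈cube-outside-I r∉I y∈r)))

  splice-row : ∀ {i k x} → splice (M (ι i)) x ∈cube M (ι k) → k ≡ i
  splice-row {i} {k} {x} y∈k with k ≟ i
  ... | yes k≡i = k≡i
  ... | no k≢i  = ⊥-elim (conflicting⇒disjoint (rows-conflict k≢i)
                            (λ j → y∈k (κ j)) (splice-∈cube-on-J (M (ι i)) x))

  agreesOffJ-transfer : ∀ {i i' x} → AgreesOn OffJ (M (ι i)) x → AgreesOn OffJ (M (ι i')) x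
  agreesOffJ-transfer {i' = i'} {x} x~i c c∉J a e
    with (r , y∈r) , _ ← partition (splice (M (ι i')) x)
    with k , refl ← splice-cube-in-I x~i y∈r
    with refl ← splice-row y∈r
    = trans (sym (splice-off-J _ x c∉J)) (y∈r c a e)

lemma4 : (q n m R C : ℕ) → 2 ≤ q → (M : Matrix q m n) →
         IsPartitionStarMatrix M → SameDimension M →
         (ι : Fin R → Fin m) (κ : Fin C → Fin n) → IsTransfractal M ι κ →
         ∀ (i₁ i₂ : Fin R) (c : Fin n) → ¬ InImage κ c →
         M (ι i₁) c ≡ M (ι i₂) c
lemma4 (suc zero) _ _ _ _ (s≤s ())
lemma4 (suc (suc _)) _ _ _ _ _ M partition _ _ _ (_ , _ , (l , _ , T-fractal) , stars-outside) _ _ _ c∉J =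
  agreesOn-⇔⇒≡ (λ _ → agreesOffJ-transfer) (λ _ → agreesOffJ-transfer) c∉J
  where open Transfractal M partition (fractal-rows-conflict {l = l} T-fractal) stars-outside
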